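{- Let $r$ be a power of the prime $p$, consider a Desarguesian net of order $r$ and degree $m\ge1$ with collinearity graph $\Gamma$, let $L$ be a line of the net, $x$ a point not on $L$, $A = x^\perp\cap L$, and let $C_{x,L}$ be the unique maximal clique of $\Gamma$ containing $\{x\}\cup A$. Then the group of linear automorphisms of the net (maps $z\mapsto cz+d$ with $c\in\mathbb{F}_r^*$, $d\in\mathbb{F}_{r^2}$) that preserve both $L$ and $C_{x,L}$ acts faithfully on $L$, and the group it induces on $L$ is exactly the group of invertible linear maps $g$ of $L$ (restrictions to $L$ of maps $z\mapsto cz+d$, $c\in\mathbb{F}_r^*$, $d\in\mathbb{F}_{r^2}$, mapping $L$ onto $L$) such that $g$ preserves $A$ and, if $g$ has a unique fixed point $c_0$ on $L$, then $c_0\in A$.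
   Context: A Desarguesian net of order $r$ and degree $m$: identify the point set with $\mathbb{F}_{r^2}$ and fix $S\subseteq\mathbb{F}_{r^2}^*$, a union of $m$ cosets of $\mathbb{F}_r^*$ in $\mathbb{F}_{r^2}^*$. Lines of the net are the sets $a+d\,\mathbb{F}_r$ with $a\in\mathbb{F}_{r^2}$, $d\in S$. The collinearity graph $\Gamma$ has vertex set $\mathbb{F}_{r^2}$, distinct vertices adjacent iff their difference lies in $S$. For a vertex $y$, $y^\perp$ is $\{y\}$ together with the neighbours of $y$. It is known that $\{x\}\cup(x^\perp\cap L)$ is a clique contained in a unique maximal clique, denoted $C_{x,L}$. -}

module Defs where

open import Level using (0ℓ) renaming (suc to lsuc)
open import Data.Nat using (ℕ; _≥_; _^_)
open import Data.Nat.Primality using (Prime)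
open import Data.Fin using (Fin)
open import Data.Bool using (Bool; T)
open import Data.Sum using (_⊎_)
open import Data.Product using (Σ; ∃; _×_; _,_)
open import Relation.Binary.PropositionalEquality using (_≡_; _≢_)
open import Relation.Nullary using (¬_)
open import Relation.Unary using (Pred; _⊆_)
open import Function.Bundles using (_↔_)
open import Algebra.Structures using (IsCommutativeRing)

record Field : Set₁ where
  infixl 6 _+_ _-_
  infixl 7 _*_
  field
    Carrier : Set
    _+_ _*_ : Carrier → Carrier → Carrier
    -_      : Carrier → Carrier
    0# 1#   : Carrier
    isCommutativeRing : IsCommutativeRing _≡_ _+_ _*_ -_ 0# 1#
    0≢1     : 0# ≢ 1#
    inverse : ∀ x → x ≢ 0# → ∃ λ y → x * y ≡ 1#
  _-_ : Carrier → Carrier → Carrier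
  x - y = x + (- y)

IsPowerOf : ℕ → ℕ → Set
IsPowerOf p r = Prime p × Σ ℕ λ k → k ≥ 1 × r ≡ p ^ k

-- The setting: F ≅ F_{r^2} (a field with r² elements) together with its
-- subfield K ≅ F_r (a decidable subset with r elements closed under the
-- field operations).
record QuadraticExtension (r : ℕ) : Set₁ where
  field
    F : Field
  open Field F public
  field
    finite : Carrier ↔ Fin (r Data.Nat.* r)
    inK    : Carrier → Bool
    cardK  : Σ Carrier (λ x → T (inK x)) ↔ Fin r
    K-0    : T (inK 0#)
    K-1    : T (inK 1#)
    K-+    : ∀ {x y} → T (inK x) → T (inK y) → T (inK (x + y))
    K-*    : ∀ {x y} → T (inK x) → T (inK y) → T (inK (x * y))
    K-neg  : ∀ {x} → T (inK x) → T (inK (- x))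
    K-inv  : ∀ {x y} → T (inK x) → x * y ≡ 1# → T (inK y)

module Net {r : ℕ} (E : QuadraticExtension r) where
  open QuadraticExtension E

  InK : Carrier → Set
  InK x = T (inK x)

  InK* : Carrier → Set
  InK* x = InK x × x ≢ 0#

  -- S = union of the m cosets (F_r^*) · ds i, i : Fin m, of F_r^* in F_{r²}^*,
  -- the representatives being nonzero and in pairwise distinct cosets.
  DistinctCosetReps : (m : ℕ) → (Fin m → Carrier) → Set
  DistinctCosetReps m ds =
    (∀ i → ds i ≢ 0#) ×
    (∀ i j → i ≢ j → ¬ (Σ Carrier λ c → InK* c × ds i ≡ c * ds j))

  InS : {m : ℕ} → (Fin m → Carrier) → Pred Carrier 0ℓ
  InS {m} ds z = Σ (Fin m) λ i → Σ Carrier λ c → InK* c × z ≡ c * ds i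

  Line : Carrier → Carrier → Pred Carrier 0ℓ
  Line a d z = Σ Carrier λ t → InK t × z ≡ a + d * t

  module WithS {m : ℕ} (ds : Fin m → Carrier) where
    S : Pred Carrier 0ℓ
    S = InS ds

    IsLine : Pred Carrier 0ℓ → Set
    IsLine L = Σ Carrier λ a → Σ Carrier λ d → S d × (∀ z → (L z → Line a d z) × (Line a d z → L z))

    Adj : Carrier → Carrier → Set
    Adj y z = y ≢ z × S (y - z)

    Perp : Carrier → Pred Carrier 0ℓ
    Perp y z = z ≡ y ⊎ Adj y z

    IsClique : Pred Carrier 0ℓ → Set
    IsClique C = ∀ y z → C y → C z → y ≢ z → Adj y z

    IsMaximalClique : Pred Carrier 0ℓ → Set₁
    IsMaximalClique C = IsClique C × (∀ (D : Pred Carrier 0ℓ) → IsClique D → C ⊆ D → D ⊆ C)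

  lin : Carrier → Carrier → Carrier → Carrier
  lin c d z = c * z + d

  PreservesSet : (Carrier → Carrier) → Pred Carrier 0ℓ → Set
  PreservesSet φ P = (∀ z → P z → P (φ z)) × (∀ w → P w → Σ Carrier λ z → P z × φ z ≡ w)

-- Call an affine map g z = c z + d with c ∈ F_r^* admissible if it maps L and A = x^⊥ ∩ L into
-- themselves and, unless it is a translation, fixes a point of A.  Writing z − a = α dL + β (x − a)
-- with α, β ∈ F_r, every point z of C off L is g x for the admissible map g z' = β z' + (z − β x);
-- conversely A together with the points g x is a clique, so C = A ∪ {g x | g admissible}.
-- The admissible maps form a group: the periods e of A (A + e ⊆ A) form a module over a subring of
-- F containing the multipliers c, which is a field because F is finite, and the commutator of two
-- admissible maps is a translation by a period; this places the fixed point of a composite in A.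
-- Hence every admissible map preserves C.  Conversely an element g of G preserves C ∩ L = A, and
-- if it fixes q ∈ L then x − g x = (1 − c)(x − q), so g x ∈ C forces q ∈ A.  Faithfulness holds
-- because an affine map fixing two points is the identity.

{-# OPTIONS --safe #-}
module Submission where

open import Defs
open import Level using (Level; 0ℓ)
open import Data.Nat as ℕ using (ℕ; zero; suc; _≥_)
import Data.Nat.Properties as ℕ
open import Data.Integer as ℤ using (ℤ; -[1+_]; +[1+_]) renaming (+_ to pos)
import Data.Integer.Properties as ℤ
open import Data.Fin as Fin using (Fin; toℕ)
import Data.Fin.Properties as Fin
import Data.Maybe as Maybe
open import Data.Bool.Properties using (T-irrelevant)
open import Data.Product using (Σ; ∃; ∃₂; _×_; _,_; proj₁; proj₂)
open import Data.Sum using (_⊎_; inj₁; inj₂)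
open import Data.Empty using (⊥-elim)
open import Data.Unit using (⊤; tt)
open import Function.Base using (_∘_)
open import Function.Bundles using (_↔_; Injection; Inverse)
open import Function.Definitions using (Injective)
open import Function.Properties.Inverse using (↔⇒↣; ↔-sym)
import Function.Endo.Propositional as Endo
open import Relation.Binary.Definitions using (DecidableEquality)
open import Relation.Binary.PropositionalEquality
open import Relation.Nullary using (¬_; Dec; yes; no)
open import Relation.Nullary.Decidable using (via-injection; dec⇒maybe)
open import Relation.Unary using (Pred; _⊆_; _∩_)
open import Algebra.Bundles using (CommutativeRing)
open import Algebra.Solver.Ring.AlmostCommutativeRing
  using (AlmostCommutativeRing; fromCommutativeRing; _-Raw-AlmostCommutative⟶_)

module IntegerCoefficients {c ℓ : Level} (R : CommutativeRing c ℓ) where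

  private
    open CommutativeRing R
      using (Carrier; _≈_; _+_; _*_; -_; 0#; 1#; ring; +-cong; +-congˡ; +-congʳ; *-congʳ; -‿cong;
             +-assoc; +-identityˡ; +-identityʳ; -‿inverseʳ; *-identityˡ; distribʳ; zeroˡ)
      renaming (refl to ≈-refl; sym to ≈-sym; trans to ≈-trans; reflexive to ≈-reflexive)
    open import Algebra.Properties.Ring ring using (-‿involutive; -‿distribˡ-*; -0#≈0#; -‿+-comm)
    open import Relation.Binary.Reasoning.Setoid (CommutativeRing.setoid R)

    -- ⟦ 1 ⟧ is 1# on the nose, so that the constant 1 of the solver reads as 1#.
    ⟦_⟧ℕ : ℕ → Carrier
    ⟦ zero ⟧ℕ        = 0#
    ⟦ suc zero ⟧ℕ    = 1#
    ⟦ suc (suc n) ⟧ℕ = 1# + ⟦ suc n ⟧ℕ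

    ⟦suc⟧ℕ : ∀ n → ⟦ suc n ⟧ℕ ≈ 1# + ⟦ n ⟧ℕ
    ⟦suc⟧ℕ zero    = ≈-sym (+-identityʳ 1#)
    ⟦suc⟧ℕ (suc n) = ≈-refl

    ⟦_⟧ : ℤ → Carrier
    ⟦ pos n ⟧    = ⟦ n ⟧ℕ
    ⟦ -[1+ n ] ⟧ = - ⟦ suc n ⟧ℕ

    ⟦≡⟧ : ∀ {i j} → i ≡ j → ⟦ i ⟧ ≈ ⟦ j ⟧
    ⟦≡⟧ e = ≈-reflexive (cong ⟦_⟧ e)

    ⟦-⟧ : ∀ i → ⟦ ℤ.- i ⟧ ≈ - ⟦ i ⟧
    ⟦-⟧ (pos zero) = ≈-sym -0#≈0#
    ⟦-⟧ +[1+ n ]   = ≈-refl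
    ⟦-⟧ -[1+ n ]   = ≈-sym (-‿involutive _)

    ⟦suc⟧ : ∀ i → ⟦ ℤ.suc i ⟧ ≈ 1# + ⟦ i ⟧
    ⟦suc⟧ (pos n)      = ⟦suc⟧ℕ n
    ⟦suc⟧ -[1+ zero ]  = ≈-sym (-‿inverseʳ 1#)
    ⟦suc⟧ -[1+ suc n ] = begin
      - ⟦ suc n ⟧ℕ                  ≈⟨ +-identityˡ _ ⟨
      0# + - ⟦ suc n ⟧ℕ             ≈⟨ +-congʳ (-‿inverseʳ 1#) ⟨
      (1# + - 1#) + - ⟦ suc n ⟧ℕ    ≈⟨ +-assoc 1# (- 1#) _ ⟩
      1# + (- 1# + - ⟦ suc n ⟧ℕ)    ≈⟨ +-congˡ (-‿+-comm 1# _) ⟩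
      1# + - (1# + ⟦ suc n ⟧ℕ)      ∎

    ⟦pos+⟧ : ∀ n j → ⟦ pos n ℤ.+ j ⟧ ≈ ⟦ n ⟧ℕ + ⟦ j ⟧
    ⟦pos+⟧ zero    j = ≈-trans (⟦≡⟧ (ℤ.+-identityˡ j)) (≈-sym (+-identityˡ _))
    ⟦pos+⟧ (suc n) j = begin
      ⟦ pos (suc n) ℤ.+ j ⟧     ≈⟨ ⟦≡⟧ (ℤ.suc-+ n j) ⟩
      ⟦ ℤ.suc (pos n ℤ.+ j) ⟧   ≈⟨ ⟦suc⟧ (pos n ℤ.+ j) ⟩
      1# + ⟦ pos n ℤ.+ j ⟧      ≈⟨ +-congˡ (⟦pos+⟧ n j) ⟩
      1# + (⟦ n ⟧ℕ + ⟦ j ⟧)     ≈⟨ +-assoc _ _ _ ⟨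
      (1# + ⟦ n ⟧ℕ) + ⟦ j ⟧     ≈⟨ +-congʳ (⟦suc⟧ℕ n) ⟨
      ⟦ suc n ⟧ℕ + ⟦ j ⟧        ∎

    ⟦+⟧ : ∀ i j → ⟦ i ℤ.+ j ⟧ ≈ ⟦ i ⟧ + ⟦ j ⟧
    ⟦+⟧ (pos n)  j = ⟦pos+⟧ n j
    ⟦+⟧ -[1+ n ] j = begin
      ⟦ -[1+ n ] ℤ.+ j ⟧              ≈⟨ ⟦≡⟧ (ℤ.neg-involutive (-[1+ n ] ℤ.+ j)) ⟨
      ⟦ ℤ.- ℤ.- (-[1+ n ] ℤ.+ j) ⟧    ≈⟨ ⟦-⟧ (ℤ.- (-[1+ n ] ℤ.+ j)) ⟩
      - ⟦ ℤ.- (-[1+ n ] ℤ.+ j) ⟧      ≈⟨ -‿cong (⟦≡⟧ (ℤ.neg-distrib-+ -[1+ n ] j)) ⟩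
      - ⟦ +[1+ n ] ℤ.+ ℤ.- j ⟧        ≈⟨ -‿cong (⟦pos+⟧ (suc n) (ℤ.- j)) ⟩
      - (⟦ suc n ⟧ℕ + ⟦ ℤ.- j ⟧)      ≈⟨ -‿cong (+-congˡ (⟦-⟧ j)) ⟩
      - (⟦ suc n ⟧ℕ + - ⟦ j ⟧)        ≈⟨ -‿+-comm _ _ ⟨
      - ⟦ suc n ⟧ℕ + - - ⟦ j ⟧        ≈⟨ +-congˡ (-‿involutive _) ⟩
      - ⟦ suc n ⟧ℕ + ⟦ j ⟧            ∎

    ⟦pos*⟧ : ∀ n j → ⟦ pos n ℤ.* j ⟧ ≈ ⟦ n ⟧ℕ * ⟦ j ⟧
    ⟦pos*⟧ zero    j = ≈-trans (⟦≡⟧ (ℤ.*-zeroˡ j)) (≈-sym (zeroˡ _))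
    ⟦pos*⟧ (suc n) j = begin
      ⟦ pos (suc n) ℤ.* j ⟧         ≈⟨ ⟦≡⟧ (ℤ.suc-* (pos n) j) ⟩
      ⟦ j ℤ.+ pos n ℤ.* j ⟧         ≈⟨ ⟦+⟧ j _ ⟩
      ⟦ j ⟧ + ⟦ pos n ℤ.* j ⟧       ≈⟨ +-cong (≈-sym (*-identityˡ _)) (⟦pos*⟧ n j) ⟩
      1# * ⟦ j ⟧ + ⟦ n ⟧ℕ * ⟦ j ⟧   ≈⟨ distribʳ _ _ _ ⟨
      (1# + ⟦ n ⟧ℕ) * ⟦ j ⟧         ≈⟨ *-congʳ (⟦suc⟧ℕ n) ⟨
      ⟦ suc n ⟧ℕ * ⟦ j ⟧            ∎

    ⟦*⟧ : ∀ i j → ⟦ i ℤ.* j ⟧ ≈ ⟦ i ⟧ * ⟦ j ⟧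
    ⟦*⟧ (pos n)  j = ⟦pos*⟧ n j
    ⟦*⟧ -[1+ n ] j = begin
      ⟦ -[1+ n ] ℤ.* j ⟧          ≈⟨ ⟦≡⟧ (ℤ.neg-distribˡ-* +[1+ n ] j) ⟨
      ⟦ ℤ.- (+[1+ n ] ℤ.* j) ⟧    ≈⟨ ⟦-⟧ (+[1+ n ] ℤ.* j) ⟩
      - ⟦ +[1+ n ] ℤ.* j ⟧        ≈⟨ -‿cong (⟦pos*⟧ (suc n) j) ⟩
      - (⟦ suc n ⟧ℕ * ⟦ j ⟧)      ≈⟨ -‿distribˡ-* _ _ ⟩
      - ⟦ suc n ⟧ℕ * ⟦ j ⟧        ∎

    R′ : AlmostCommutativeRing c ℓ
    R′ = fromCommutativeRing R

    ℤ⟶R : ℤ.+-*-rawRing -Raw-AlmostCommutative⟶ R′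
    ℤ⟶R = record
      { ⟦_⟧    = ⟦_⟧
      ; +-homo = ⟦+⟧
      ; *-homo = ⟦*⟧
      ; -‿homo = ⟦-⟧
      ; 0-homo = ≈-refl
      ; 1-homo = ≈-refl
      }

  open import Algebra.Solver.Ring ℤ.+-*-rawRing R′ ℤ⟶R
    (λ i j → Maybe.map ⟦≡⟧ (dec⇒maybe (i ℤ.≟ j))) public

module _ {X : Set} {n : ℕ} (finite : X ↔ Fin n) where

  private
    toFin : X → Fin n
    toFin = Inverse.to finite

    toFin-injective : Injective _≡_ _≡_ toFin
    toFin-injective = Injection.injective (↔⇒↣ finite)

  ≟-finite : DecidableEquality X
  ≟-finite = via-injection (↔⇒↣ finite) Fin._≟_

  module _ {f : X → X} (f-injective : Injective _≡_ _≡_ f) where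
    open Endo X using (_^_; ^-homo)

    ^-injective : ∀ k → Injective _≡_ _≡_ (f ^ k)
    ^-injective zero    e = e
    ^-injective (suc k) e = ^-injective k (f-injective e)

    -- Two of the n + 1 points w, f w, …, fⁿ w coincide; cancelling the first gives w = f^(o+1) w.
    on-a-cycle : ∀ w → ∃ λ o → f ((f ^ o) w) ≡ w
    on-a-cycle w with Fin.pigeonhole (ℕ.n<1+n n) (λ i → toFin ((f ^ toℕ i) w))
    ... | i , j , i<j , e with ℕ.m≤n⇒∃[o]m+o≡n i<j
    ... | o , i+1+o≡j = o , sym (^-injective (toℕ i) (begin
          (f ^ toℕ i) w                 ≡⟨ toFin-injective e ⟩
          (f ^ toℕ j) w                 ≡⟨ cong (λ k → (f ^ k) w) (trans (sym i+1+o≡j) (sym (ℕ.+-suc _ o))) ⟩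
          (f ^ (toℕ i ℕ.+ suc o)) w     ≡⟨ cong-app (^-homo f (toℕ i) (suc o)) w ⟩
          (f ^ toℕ i) ((f ^ suc o) w)   ∎))
      where open ≡-Reasoning

    injective-closed⇒surjective : ∀ {ℓ} (P : Pred X ℓ) → (∀ z → P z → P (f z)) →
                                  ∀ w → P w → ∃ λ z → P z × f z ≡ w
    injective-closed⇒surjective P f-closed w Pw =
      let o , e = on-a-cycle w in (f ^ o) w , ^-closed o Pw , e
      where
        ^-closed : ∀ k {z} → P z → P ((f ^ k) z)
        ^-closed zero    Pz = Pz
        ^-closed (suc k) Pz = f-closed _ (^-closed k Pz)

    injective-closed⇒inverse-closed : ∀ {ℓ} (P : Pred X ℓ) → (∀ z → P z → P (f z)) →
                                      {g : X → X} → (∀ z → g (f z) ≡ z) → ∀ w → P w → P (g w)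
    injective-closed⇒inverse-closed P f-closed {g} g∘f≗id w Pw =
      let z , Pz , fz≡w = injective-closed⇒surjective P f-closed w Pw
      in subst P (trans (sym (g∘f≗id z)) (cong g fz≡w)) Pz

module FieldProperties (F : Field) where
  open Field F

  commutativeRing : CommutativeRing 0ℓ 0ℓ
  commutativeRing = record { isCommutativeRing = isCommutativeRing }

  open CommutativeRing commutativeRing public
    using (+-assoc; +-identityʳ; -‿inverseʳ; *-assoc; *-identityˡ; *-identityʳ; distribʳ; zeroʳ; +-group)
  open import Algebra.Properties.Group +-group public using () renaming (x∙y⁻¹≈ε⇒x≈y to x-y≡0⇒x≡y)
  open IntegerCoefficients commutativeRing public using (solve; _:=_; _:+_; _:*_; _:-_; :-_; con; Polynomial)

  :0 :1 : ∀ {k} → Polynomial k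
  :0 = con (pos 0)
  :1 = con (pos 1)

  -- In the style of `linear_combination`: X ≡ Y follows from a ≡ b and the identity X = Y + k (a − b).
  combine : ∀ {X Y a b} k → X ≡ Y + k * (a - b) → a ≡ b → X ≡ Y
  combine {Y = Y} {b = b} k e refl = begin
    _                  ≡⟨ e ⟩
    Y + k * (b - b)    ≡⟨ cong (λ t → Y + k * t) (-‿inverseʳ b) ⟩
    Y + k * 0#         ≡⟨ cong (Y +_) (zeroʳ k) ⟩
    Y + 0#             ≡⟨ +-identityʳ Y ⟩
    Y                  ∎
    where open ≡-Reasoning

  combine₂ : ∀ {X Y a b a′ b′} k k′ → X ≡ Y + k * (a - b) + k′ * (a′ - b′) →
             a ≡ b → a′ ≡ b′ → X ≡ Y
  combine₂ k k′ e a≡b a′≡b′ = combine k (combine k′ e a′≡b′) a≡b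

  x*y≡0⇒y≡0 : ∀ {x y} → x ≢ 0# → x * y ≡ 0# → y ≡ 0#
  x*y≡0⇒y≡0 {x} {y} x≢0 xy≡0 with inverse x x≢0
  ... | x⁻¹ , xx⁻¹≡1 = combine₂ x⁻¹ (- y)
    (solve 3 (λ x y x⁻¹ → y := :0 :+ x⁻¹ :* (x :* y :- :0) :+ (:- y) :* (x :* x⁻¹ :- :1)) refl x y x⁻¹)
    xy≡0 xx⁻¹≡1

  *-nonzero : ∀ {x y} → x ≢ 0# → y ≢ 0# → x * y ≢ 0#
  *-nonzero x≢0 y≢0 xy≡0 = y≢0 (x*y≡0⇒y≡0 x≢0 xy≡0)

  *-cancelˡ : ∀ {x y z} → x ≢ 0# → x * y ≡ x * z → y ≡ z
  *-cancelˡ {x} {y} {z} x≢0 e = x-y≡0⇒x≡y y z (x*y≡0⇒y≡0 x≢0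
    (combine 1# (solve 3 (λ x y z → x :* (y :- z) := :0 :+ :1 :* (x :* y :- x :* z)) refl x y z) e))

  inverse-nonzero : ∀ {x y} → x * y ≡ 1# → y ≢ 0#
  inverse-nonzero {x} xy≡1 y≡0 = 0≢1 (trans (sym (zeroʳ x)) (trans (cong (x *_) (sym y≡0)) xy≡1))

  1-x≢0 : ∀ {x} → x ≢ 1# → 1# - x ≢ 0#
  1-x≢0 x≢1 e = x≢1 (sym (x-y≡0⇒x≡y _ _ e))

  affine-injective : ∀ {c d y z} → c ≢ 0# → c * y + d ≡ c * z + d → y ≡ z
  affine-injective {c} {d} {y} {z} c≢0 e = *-cancelˡ c≢0
    (combine 1# (solve 4 (λ c d y z → c :* y := c :* z :+ :1 :* ((c :* y :+ d) :- (c :* z :+ d))) refl c d y z) e)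

  affine-∘ : ∀ c d c′ d′ z → c * (c′ * z + d′) + d ≡ (c * c′) * z + (c * d′ + d)
  affine-∘ = solve 5 (λ c d c′ d′ z → c :* (c′ :* z :+ d′) :+ d := (c :* c′) :* z :+ (c :* d′ :+ d))
                     refl

  affine-fixed-point : ∀ {c} d → c ≢ 1# → ∃ λ p → c * p + d ≡ p
  affine-fixed-point {c} d c≢1 with inverse (1# - c) (1-x≢0 c≢1)
  ... | u , [1-c]u≡1 = u * d , combine (- d)
    (solve 3 (λ c u d → c :* (u :* d) :+ d := u :* d :+ (:- d) :* ((:1 :- c) :* u :- :1)) refl c u d) [1-c]u≡1

  affine-fixed-unique : ∀ {c d p q} → c ≢ 1# → c * p + d ≡ p → c * q + d ≡ q → p ≡ q
  affine-fixed-unique {c} {d} {p} {q} c≢1 fp fq = x-y≡0⇒x≡y p q (x*y≡0⇒y≡0 (1-x≢0 c≢1)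
    (combine₂ (- 1#) 1# (solve 4 (λ c d p q → (:1 :- c) :* (p :- q) := :0
       :+ (:- :1) :* ((c :* p :+ d) :- p) :+ :1 :* ((c :* q :+ d) :- q)) refl c d p q) fp fq))

  translation-fixing-point≡id : ∀ {c d p} → c ≡ 1# → c * p + d ≡ p → ∀ z → c * z + d ≡ z
  translation-fixing-point≡id {c} {d} {p} c≡1 fp z = combine₂ (z - p) 1#
    (solve 4 (λ c d p z → c :* z :+ d := z :+ (z :- p) :* (c :- :1) :+ :1 :* ((c :* p :+ d) :- p)) refl c d p z)
    c≡1 fp

  affine-meet : ∀ {c₁ c₂} d₁ d₂ → c₁ ≢ c₂ → ∃ λ q → c₁ * q + d₁ ≡ c₂ * q + d₂
  affine-meet {c₁} {c₂} d₁ d₂ c₁≢c₂ with inverse (c₁ - c₂) (λ e → c₁≢c₂ (x-y≡0⇒x≡y c₁ c₂ e))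
  ... | v , [c₁-c₂]v≡1 = v * (d₂ - d₁) , combine (d₂ - d₁)
    (solve 5 (λ c₁ c₂ d₁ d₂ v → c₁ :* (v :* (d₂ :- d₁)) :+ d₁ :=
                                 c₂ :* (v :* (d₂ :- d₁)) :+ d₂ :+ (d₂ :- d₁) :* ((c₁ :- c₂) :* v :- :1))
             refl c₁ c₂ d₁ d₂ v)
    [c₁-c₂]v≡1

  module _ {c c′ : Carrier} (cc′≡1 : c * c′ ≡ 1#) (d : Carrier) where

    affine-inverseˡ : ∀ z → c′ * (c * z + d) + - (c′ * d) ≡ z
    affine-inverseˡ z = combine z
      (solve 4 (λ c d c′ z → c′ :* (c :* z :+ d) :+ :- (c′ :* d) := z :+ z :* (c :* c′ :- :1)) refl c d c′ z)
      cc′≡1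

    affine-inverseʳ : ∀ w → c * (c′ * w + - (c′ * d)) + d ≡ w
    affine-inverseʳ w = combine (w - d)
      (solve 4 (λ c d c′ w → c :* (c′ :* w :+ :- (c′ :* d)) :+ d := w :+ (w :- d) :* (c :* c′ :- :1))
               refl c d c′ w)
      cc′≡1

  affine-fixing-two-points≡id : ∀ {c d p q} → p ≢ q → c * p + d ≡ p → c * q + d ≡ q →
                                ∀ z → c * z + d ≡ z
  affine-fixing-two-points≡id {c} {d} {p} {q} p≢q fp fq = translation-fixing-point≡id c≡1 fp
    where
      c≡1 : c ≡ 1#
      c≡1 = x-y≡0⇒x≡y c 1# (x*y≡0⇒y≡0 (λ e → p≢q (x-y≡0⇒x≡y p q e)) (combine₂ 1# (- 1#)
        (solve 4 (λ c d p q → (p :- q) :* (c :- :1) := :0 :+ :1 :* ((c :* p :+ d) :- p)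
           :+ (:- :1) :* ((c :* q :+ d) :- q)) refl c d p q) fp fq))

module AffineStabiliser (F : Field) {n : ℕ} (finite : Field.Carrier F ↔ Fin n)
                        (B : Pred (Field.Carrier F) 0ℓ) where
  open Field F
  open FieldProperties F

  record Admissible (c d : Carrier) : Set where
    field
      nonzero : c ≢ 0#
      maps-B  : ∀ z → B z → B (c * z + d)
      fixed⇒B : c ≢ 1# → ∀ q → c * q + d ≡ q → B q

  open Admissible

  Period : Pred Carrier 0ℓ
  Period e = ∀ z → B z → B (z + e)

  Multiplier : Pred Carrier 0ℓ
  Multiplier w = ∀ e → Period e → Period (w * e)

  preimage-in-B : ∀ {c d} → Admissible c d → ∀ w → B w → ∃ λ z → B z × c * z + d ≡ w
  preimage-in-B g = injective-closed⇒surjective finite (affine-injective (nonzero g)) B (maps-B g)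

  period-+ : ∀ {e e′} → Period e → Period e′ → Period (e + e′)
  period-+ {e} {e′} pe pe′ z Bz = subst B (+-assoc z e e′) (pe′ _ (pe z Bz))

  period-neg : ∀ {e} → Period e → Period (- e)
  period-neg {e} pe = injective-closed⇒inverse-closed finite +e-injective B pe
    (λ z → solve 2 (λ z e → (z :+ e) :- e := z) refl z e)
    where
      +e-injective : ∀ {y z} → y + e ≡ z + e → y ≡ z
      +e-injective {y} {z} = combine 1# (solve 3 (λ y z e → y := z :+ :1 :* ((y :+ e) :- (z :+ e))) refl y z e)

  multiplier-1 : Multiplier 1#
  multiplier-1 e pe = subst Period (sym (*-identityˡ e)) pe

  multiplier-+ : ∀ {u v} → Multiplier u → Multiplier v → Multiplier (u + v)
  multiplier-+ {u} {v} mu mv e pe = subst Period (sym (distribʳ e u v)) (period-+ (mu e pe) (mv e pe))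

  multiplier-neg : ∀ {u} → Multiplier u → Multiplier (- u)
  multiplier-neg {u} mu e pe =
    subst Period (solve 2 (λ u e → :- (u :* e) := (:- u) :* e) refl u e) (period-neg (mu e pe))

  multiplier-* : ∀ {u v} → Multiplier u → Multiplier v → Multiplier (u * v)
  multiplier-* {u} {v} mu mv e pe = subst Period (sym (*-assoc u v e)) (mu _ (mv e pe))

  -- The multipliers form a subring of a finite field, so they are closed under inverses.
  multiplier-cancel : ∀ {w e} → Multiplier w → w ≢ 0# → Period (w * e) → Period e
  multiplier-cancel {w} {e} mw w≢0 pwe =
    let w⁻¹ , mw⁻¹ , ww⁻¹≡1 = injective-closed⇒surjective finite (*-cancelˡ w≢0) Multiplier
                                 (λ _ → multiplier-* mw) 1# multiplier-1
    in subst Period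
         (combine e (solve 3 (λ w w⁻¹ e → w⁻¹ :* (w :* e) := e :+ e :* (w :* w⁻¹ :- :1)) refl w w⁻¹ e) ww⁻¹≡1)
         (mw⁻¹ _ pwe)

  admissible⇒multiplier : ∀ {c d} → Admissible c d → Multiplier c
  admissible⇒multiplier {c} {d} g e pe z Bz =
    let u , Bu , gu≡z = preimage-in-B g z Bz
    in subst B (trans (solve 4 (λ c d u e → c :* (u :+ e) :+ d := (c :* u :+ d) :+ c :* e) refl c d u e)
                      (cong (_+ c * e) gu≡z))
             (maps-B g _ (pe u Bu))

  commutator-period : ∀ {c₁ d₁ c₂ d₂} → Admissible c₁ d₁ → Admissible c₂ d₂ →
                      Period ((c₁ - 1#) * d₂ + (1# - c₂) * d₁)
  commutator-period {c₁} {d₁} {c₂} {d₂} g₁ g₂ z Bz =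
    let u , Bu , g₂g₁u≡z = injective-closed⇒surjective finite
          (λ e → affine-injective (nonzero g₁) (affine-injective (nonzero g₂) e)) B
          (λ u Bu → maps-B g₂ _ (maps-B g₁ u Bu)) z Bz
    in subst B (trans (solve 5 (λ c₁ d₁ c₂ d₂ u → c₁ :* (c₂ :* u :+ d₂) :+ d₁ :=
                                  (c₂ :* (c₁ :* u :+ d₁) :+ d₂) :+ ((c₁ :- :1) :* d₂ :+ (:1 :- c₂) :* d₁))
                              refl c₁ d₁ c₂ d₂ u)
                      (cong (_+ _) g₂g₁u≡z))
             (maps-B g₁ _ (maps-B g₂ u Bu))

  B-closed-under-scaled-period : ∀ {p q w} → B p → Multiplier w → w ≢ 0# → Period (w * (q - p)) → B q
  B-closed-under-scaled-period {p} {q} Bp mw w≢0 pw = subst B (solve 2 (λ p q → p :+ (q :- p) := q) refl p q)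
                                               (multiplier-cancel mw w≢0 pw p Bp)

  -- For the fixed point p of g₂ (or of g₁), an invertible multiplier times q − p is a multiple of
  -- the commutator period.
  ∘-fixed⇒B : ∀ {c₁ d₁ c₂ d₂ q} → Admissible c₁ d₁ → Admissible c₂ d₂ → c₁ * c₂ ≢ 1# →
              c₁ * (c₂ * q + d₂) + d₁ ≡ q → B q
  ∘-fixed⇒B {c₁} {d₁} {c₂} {d₂} {q} g₁ g₂ c₁c₂≢1 fq with ≟-finite finite c₂ 1#
  ... | no c₂≢1 =
    let p₂ , fp₂ = affine-fixed-point d₂ c₂≢1
        key = combine₂ (- (1# - c₂)) (1# - c₁ * c₂)
          (solve 6 (λ c₁ c₂ d₁ d₂ q p₂ → ((:1 :- c₂) :* (:1 :- c₁ :* c₂)) :* (q :- p₂) :=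
             ((c₁ :- :1) :* d₂ :+ (:1 :- c₂) :* d₁)
             :+ (:- (:1 :- c₂)) :* ((c₁ :* (c₂ :* q :+ d₂) :+ d₁) :- q)
             :+ (:1 :- c₁ :* c₂) :* ((c₂ :* p₂ :+ d₂) :- p₂)) refl c₁ c₂ d₁ d₂ q p₂)
          fq fp₂
    in B-closed-under-scaled-period (fixed⇒B g₂ c₂≢1 p₂ fp₂)
         (multiplier-* (multiplier-+ multiplier-1 (multiplier-neg m₂))
                       (multiplier-+ multiplier-1 (multiplier-neg (multiplier-* m₁ m₂))))
         (*-nonzero (1-x≢0 c₂≢1) (1-x≢0 c₁c₂≢1))
         (subst Period (sym key) (commutator-period g₁ g₂))
    where m₁ = admissible⇒multiplier g₁
          m₂ = admissible⇒multiplier g₂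
  ... | yes c₂≡1 =
    let c₁≢1 = λ c₁≡1 → c₁c₂≢1 (trans (cong₂ _*_ c₁≡1 c₂≡1) (*-identityʳ 1#))
        p₁ , fp₁ = affine-fixed-point d₁ c₁≢1
        key = combine₂ (1# - c₁) (- (1# - c₁ * c₂))
          (solve 6 (λ c₁ c₂ d₁ d₂ q p₁ → ((c₁ :- :1) :* (:1 :- c₁ :* c₂)) :* (q :- p₁) :=
             c₁ :* ((c₁ :- :1) :* d₂ :+ (:1 :- c₂) :* d₁)
             :+ (:1 :- c₁) :* ((c₁ :* (c₂ :* q :+ d₂) :+ d₁) :- q)
             :+ (:- (:1 :- c₁ :* c₂)) :* ((c₁ :* p₁ :+ d₁) :- p₁)) refl c₁ c₂ d₁ d₂ q p₁)
          fq fp₁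
    in B-closed-under-scaled-period (fixed⇒B g₁ c₁≢1 p₁ fp₁)
         (multiplier-* (multiplier-+ m₁ (multiplier-neg multiplier-1))
                       (multiplier-+ multiplier-1 (multiplier-neg (multiplier-* m₁ m₂))))
         (*-nonzero (λ e → c₁≢1 (x-y≡0⇒x≡y c₁ 1# e)) (1-x≢0 c₁c₂≢1))
         (subst Period (sym key) (m₁ _ (commutator-period g₁ g₂)))
    where m₁ = admissible⇒multiplier g₁
          m₂ = admissible⇒multiplier g₂

  admissible-∘ : ∀ {c₁ d₁ c₂ d₂} → Admissible c₁ d₁ → Admissible c₂ d₂ →
                 Admissible (c₁ * c₂) (c₁ * d₂ + d₁)
  admissible-∘ {c₁} {d₁} {c₂} {d₂} g₁ g₂ = record
    { nonzero = *-nonzero (nonzero g₁) (nonzero g₂)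
    ; maps-B  = λ z Bz → subst B (affine-∘ c₁ d₁ c₂ d₂ z) (maps-B g₁ _ (maps-B g₂ z Bz))
    ; fixed⇒B = λ c₁c₂≢1 q fq → ∘-fixed⇒B g₁ g₂ c₁c₂≢1 (trans (affine-∘ c₁ d₁ c₂ d₂ q) fq)
    }

  admissible-inverse : ∀ {c d c′} → c * c′ ≡ 1# → Admissible c d → Admissible c′ (- (c′ * d))
  admissible-inverse {c} {d} {c′} cc′≡1 g = record
    { nonzero = inverse-nonzero cc′≡1
    ; maps-B  = injective-closed⇒inverse-closed finite (affine-injective (nonzero g)) B (maps-B g)
                  (affine-inverseˡ cc′≡1 d)
    ; fixed⇒B = λ c′≢1 q fq → fixed⇒B g (c′≢1 ∘ c≡1⇒c′≡1) q
                                 (trans (cong (λ t → c * t + d) (sym fq)) (affine-inverseʳ cc′≡1 d q))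
    }
    where
      c≡1⇒c′≡1 : c ≡ 1# → c′ ≡ 1#
      c≡1⇒c′≡1 c≡1 = trans (sym (*-identityˡ c′)) (trans (cong (_* c′) (sym c≡1)) cc′≡1)

  admissible-meet⇒B : ∀ {c₁ d₁ c₂ d₂ q} → Admissible c₁ d₁ → Admissible c₂ d₂ → c₁ ≢ c₂ →
                      c₁ * q + d₁ ≡ c₂ * q + d₂ → B q
  admissible-meet⇒B {c₁} {d₁} {c₂} {d₂} {q} g₁ g₂ c₁≢c₂ g₁q≡g₂q with inverse c₂ (nonzero g₂)
  ... | c₂′ , c₂c₂′≡1 = fixed⇒B (admissible-∘ (admissible-inverse c₂c₂′≡1 g₂) g₁) c₂′c₁≢1 q
        (trans (sym (affine-∘ c₂′ (- (c₂′ * d₂)) c₁ d₁ q))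
               (trans (cong (λ t → c₂′ * t + - (c₂′ * d₂)) g₁q≡g₂q) (affine-inverseˡ c₂c₂′≡1 d₂ q)))
    where
      c₂′c₁≢1 : c₂′ * c₁ ≢ 1#
      c₂′c₁≢1 e = c₁≢c₂ (combine₂ (- c₁) c₂
        (solve 3 (λ c₁ c₂ c₂′ → c₁ := c₂ :+ (:- c₁) :* (c₂ :* c₂′ :- :1) :+ c₂ :* (c₂′ :* c₁ :- :1))
                 refl c₁ c₂ c₂′)
        c₂c₂′≡1 e)

module SubfieldProperties {r : ℕ} (E : QuadraticExtension r) where
  open QuadraticExtension E
  open Net E
  open FieldProperties F

  K-sub : ∀ {x y} → InK x → InK y → InK (x - y)
  K-sub x∈K y∈K = K-+ x∈K (K-neg y∈K)

  K*-* : ∀ {x y} → InK* x → InK* y → InK* (x * y)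
  K*-* (x∈K , x≢0) (y∈K , y≢0) = K-* x∈K y∈K , *-nonzero x≢0 y≢0

  K*-inverse : ∀ {x} → InK* x → ∃ λ x′ → InK* x′ × x * x′ ≡ 1#
  K*-inverse {x} (x∈K , x≢0) with inverse x x≢0
  ... | x′ , xx′≡1 = x′ , (K-inv x∈K xx′≡1 , inverse-nonzero xx′≡1) , xx′≡1

  K*-sub : ∀ {x y} → InK x → InK y → x ≢ y → InK* (x - y)
  K*-sub x∈K y∈K x≢y = K-sub x∈K y∈K , λ e → x≢y (x-y≡0⇒x≡y _ _ e)

  K*-neg : ∀ {x} → InK* x → InK* (- x)
  K*-neg {x} (x∈K , x≢0) = K-neg x∈K , λ -x≡0 → x≢0
    (combine 1# (solve 1 (λ x → x := :0 :+ :1 :* (:0 :- (:- x))) refl x) (sym -x≡0))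

  K-coordinates-unique : ∀ {u v α β α′ β′} → u ≢ 0# → (∀ t → InK t → v ≢ t * u) →
                         InK α → InK β → InK α′ → InK β′ →
                         α * u + β * v ≡ α′ * u + β′ * v → α ≡ α′ × β ≡ β′
  K-coordinates-unique {u} {v} {α} {β} {α′} {β′} u≢0 v∉Ku α∈K β∈K α′∈K β′∈K e
    with ≟-finite finite β β′
  ... | yes β≡β′ = x-y≡0⇒x≡y α α′ (x*y≡0⇒y≡0 u≢0 (combine₂ 1# (- v)
          (solve 6 (λ α α′ β β′ u v → u :* (α :- α′) :=
                      :0 :+ :1 :* ((α :* u :+ β :* v) :- (α′ :* u :+ β′ :* v)) :+ (:- v) :* (β :- β′))
                   refl α α′ β β′ u v)
          e β≡β′)) , β≡β′
  ... | no β≢β′ with K*-inverse (K*-sub β∈K β′∈K β≢β′)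
  ... | s , (s∈K , _) , [β-β′]s≡1 = ⊥-elim (v∉Ku (s * (α′ - α)) (K-* s∈K (K-sub α′∈K α∈K))
          (combine₂ s (- v)
            (solve 7 (λ α α′ β β′ u v s → v := (s :* (α′ :- α)) :* u
                        :+ s :* ((α :* u :+ β :* v) :- (α′ :* u :+ β′ :* v)) :+ (:- v) :* ((β :- β′) :* s :- :1))
                     refl α α′ β β′ u v s)
            e [β-β′]s≡1))

  -- (α, β) ↦ α u + β v is injective on K × K, which has as many elements as F.
  K-basis : ∀ {u v} → u ≢ 0# → (∀ t → InK t → v ≢ t * u) →
            ∀ z → ∃₂ λ α β → InK α × InK β × z ≡ α * u + β * v
  K-basis {u} {v} u≢0 v∉Ku z =
    let w , _ , hw≡z = injective-closed⇒surjective finite h-injective (λ _ → ⊤) (λ _ _ → tt) z tt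
    in element (proj₁ (coordinates w)) , element (proj₂ (coordinates w)) ,
       element∈K _ , element∈K _ , sym hw≡z
    where
      element : Fin r → Carrier
      element i = proj₁ (Inverse.from cardK i)

      element∈K : ∀ i → InK (element i)
      element∈K i = proj₂ (Inverse.from cardK i)

      element-injective : Injective _≡_ _≡_ element
      element-injective {i} {j} e = Injection.injective (↔⇒↣ (↔-sym cardK)) (Σ-≡ e)
        where
          Σ-≡ : ∀ {s t : Σ Carrier InK} → proj₁ s ≡ proj₁ t → s ≡ t
          Σ-≡ {x , p} {.x , q} refl = cong (x ,_) (T-irrelevant p q)

      coordinates : Carrier → Fin r × Fin r
      coordinates = Inverse.to (Fin.*↔× {r} {r}) ∘ Inverse.to finite

      coordinates-injective : Injective _≡_ _≡_ coordinates
      coordinates-injective e =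
        Injection.injective (↔⇒↣ finite) (Injection.injective (↔⇒↣ (Fin.*↔× {r} {r})) e)

      h : Carrier → Carrier
      h w = element (proj₁ (coordinates w)) * u + element (proj₂ (coordinates w)) * v

      h-injective : Injective _≡_ _≡_ h
      h-injective {w} {w′} e =
        let α≡α′ , β≡β′ = K-coordinates-unique u≢0 v∉Ku
                             (element∈K _) (element∈K _) (element∈K _) (element∈K _) e
        in coordinates-injective (cong₂ _,_ (element-injective α≡α′) (element-injective β≡β′))

module CollinearityProperties {r : ℕ} (E : QuadraticExtension r) {m : ℕ}
                              (ds : Fin m → QuadraticExtension.Carrier E) where
  open QuadraticExtension E
  open Net E
  open WithS ds
  open FieldProperties F
  open SubfieldProperties E

  S-nonzero : DistinctCosetReps m ds → ∀ {z} → S z → z ≢ 0#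
  S-nonzero (ds≢0 , _) (i , k , (_ , k≢0) , z≡kdᵢ) z≡0 =
    *-nonzero k≢0 (ds≢0 i) (trans (sym z≡kdᵢ) z≡0)

  S-scale : ∀ {k z} → InK* k → S z → S (k * z)
  S-scale {k} k∈K* (i , k′ , k′∈K* , z≡k′dᵢ) =
    i , k * k′ , K*-* k∈K* k′∈K* , trans (cong (k *_) z≡k′dᵢ) (sym (*-assoc k k′ (ds i)))

  S-unscale : ∀ {k z} → InK* k → S (k * z) → S z
  S-unscale {k} {z} k∈K* Skz with K*-inverse k∈K*
  ... | k′ , k′∈K* , kk′≡1 = subst S
          (combine z (solve 3 (λ k k′ z → k′ :* (k :* z) := z :+ z :* (k :* k′ :- :1)) refl k k′ z) kk′≡1)
          (S-scale k′∈K* Skz)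

  Adj-sym : ∀ {y z} → Adj y z → Adj z y
  Adj-sym {y} {z} (y≢z , Sy-z) = (λ e → y≢z (sym e)) ,
    subst S (solve 2 (λ y z → (:- :1) :* (y :- z) := z :- y) refl y z)
            (S-scale (K*-neg (K-1 , 0≢1 ∘ sym)) Sy-z)

  lin-Adj : ∀ {c d y z} → InK* c → Adj y z → Adj (lin c d y) (lin c d z)
  lin-Adj {c} {d} {y} {z} c∈K* (y≢z , Sy-z) = (λ e → y≢z (affine-injective (proj₂ c∈K*) e)) ,
    subst S (solve 4 (λ c d y z → c :* (y :- z) := (c :* y :+ d) :- (c :* z :+ d)) refl c d y z)
            (S-scale c∈K* Sy-z)

module _ {r : ℕ} (E : QuadraticExtension r) where
  open QuadraticExtension E
  open Net E

  module CliqueOfPointAndLine {m : ℕ} (ds : Fin m → Carrier) (ds-reps : DistinctCosetReps m ds)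
    (L : Pred Carrier 0ℓ) (a dL : Carrier) (SdL : WithS.S ds dL)
    (L⇔Line : ∀ z → (L z → Line a dL z) × (Line a dL z → L z))
    (x : Carrier) (x∉L : ¬ L x)
    (C : Pred Carrier 0ℓ) (C-maximal : WithS.IsMaximalClique ds C) (Cx : C x) (A⊆C : WithS.Perp ds x ∩ L ⊆ C)
    where

    open WithS ds
    open FieldProperties F
    open SubfieldProperties E
    open CollinearityProperties E ds

    A : Pred Carrier 0ℓ
    A = Perp x ∩ L

    open AffineStabiliser F finite A
    open Admissible

    C-clique : IsClique C
    C-clique = proj₁ C-maximal

    L-point : ∀ {t} → InK t → L (a + dL * t)
    L-point t∈K = proj₂ (L⇔Line _) (_ , t∈K , refl)

    L-coordinate : ∀ {z} → L z → ∃ λ t → InK t × z ≡ a + dL * t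
    L-coordinate {z} = proj₁ (L⇔Line z)

    L-a : L a
    L-a = subst L (solve 2 (λ a d → a :+ d :* :0 := a) refl a dL) (L-point K-0)

    L-a+dL : L (a + dL * 1#)
    L-a+dL = L-point K-1

    a≢a+dL : a ≢ a + dL * 1#
    a≢a+dL e = S-nonzero ds-reps SdL
      (combine 1# (solve 2 (λ a d → d := :0 :+ :1 :* ((a :+ d :* :1) :- a)) refl a dL) (sym e))

    L-adjacent : ∀ {y z} → L y → L z → y ≢ z → Adj y z
    L-adjacent {y} {z} Ly Lz y≢z with L-coordinate Ly | L-coordinate Lz
    ... | s , s∈K , y≡ | t , t∈K , z≡ = y≢z , subst S (sym y-z≡) (S-scale (K*-sub s∈K t∈K s≢t) SdL)
      where
        s≢t : s ≢ t
        s≢t s≡t = y≢z (trans y≡ (trans (cong (λ u → a + dL * u) s≡t) (sym z≡)))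
        y-z≡ : y - z ≡ (s - t) * dL
        y-z≡ = combine₂ 1# (- 1#) (solve 6 (λ y z s t a d → y :- z := (s :- t) :* d
                 :+ :1 :* (y :- (a :+ d :* s)) :+ (:- :1) :* (z :- (a :+ d :* t))) refl y z s t a dL) y≡ z≡

    C∩L⊆A : ∀ {w} → C w → L w → A w
    C∩L⊆A {w} Cw Lw = inj₂ (C-clique x w Cx Cw (λ x≡w → x∉L (subst L (sym x≡w) Lw))) , Lw

    A⇒Adj-x : ∀ {w} → A w → Adj x w
    A⇒Adj-x (inj₁ w≡x , Lw) = ⊥-elim (x∉L (subst L w≡x Lw))
    A⇒Adj-x (inj₂ x~w , _)  = x~w

    fixed-point-on-L : ∀ {c d q} → InK* c → (∀ z → L z → L (lin c d z)) → c ≢ 1# → lin c d q ≡ q → L q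
    fixed-point-on-L {c} {d} {q} c∈K* maps-L c≢1 fq
      with L-coordinate (maps-L a L-a) | inverse (1# - c) (1-x≢0 c≢1)
    ... | s , s∈K , ga≡ | u , [1-c]u≡1 =
      subst L (affine-fixed-unique c≢1 fp fq) (L-point (K-* s∈K (K-inv (K-sub K-1 (proj₁ c∈K*)) [1-c]u≡1)))
      where
        fp : lin c d (a + dL * (s * u)) ≡ a + dL * (s * u)
        fp = combine₂ 1# (- (dL * s))
          (solve 6 (λ c d a dL s u → c :* (a :+ dL :* (s :* u)) :+ d := a :+ dL :* (s :* u)
                      :+ :1 :* ((c :* a :+ d) :- (a :+ dL :* s)) :+ (:- (dL :* s)) :* ((:1 :- c) :* u :- :1))
                   refl c d a dL s u)
          ga≡ [1-c]u≡1

    -- x − g x = (1 − c)(x − q) with 1 − c ∈ K*, so g x ∈ C forces x and q to be collinear.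
    fixed-point-in-A : ∀ {c d q} → InK* c → c ≢ 1# → lin c d q ≡ q → L q → C (lin c d x) → A q
    fixed-point-in-A {c} {d} {q} c∈K* c≢1 fq Lq Cgx =
      inj₂ (x≢q , S-unscale (K*-sub K-1 (proj₁ c∈K*) (c≢1 ∘ sym)) (subst S x-gx≡ (proj₂ x~gx))) , Lq
      where
        x≢q : x ≢ q
        x≢q x≡q = x∉L (subst L (sym x≡q) Lq)
        x-gx≡ : x - lin c d x ≡ (1# - c) * (x - q)
        x-gx≡ = combine (- 1#) (solve 4 (λ c d x q → x :- (c :* x :+ d) := (:1 :- c) :* (x :- q)
                  :+ (:- :1) :* ((c :* q :+ d) :- q)) refl c d x q) fq
        x~gx : Adj x (lin c d x)
        x~gx = C-clique x _ Cx Cgx λ x≡gx → x≢q (x-y≡0⇒x≡y x q (x*y≡0⇒y≡0 (1-x≢0 c≢1)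
                 (trans (sym x-gx≡) (trans (cong (_-_ x) (sym x≡gx)) (-‿inverseʳ x)))))

    record NetAdmissible (c d : Carrier) : Set where
      field
        scalar∈K   : InK c
        maps-L     : ∀ z → L z → L (lin c d z)
        admissible : Admissible c d

      scalar∈K* : InK* c
      scalar∈K* = scalar∈K , nonzero admissible

    open NetAdmissible

    netAdmissible-∘ : ∀ {c₁ d₁ c₂ d₂} → NetAdmissible c₁ d₁ → NetAdmissible c₂ d₂ →
                      NetAdmissible (c₁ * c₂) (c₁ * d₂ + d₁)
    netAdmissible-∘ {c₁} {d₁} {c₂} {d₂} g₁ g₂ = record
      { scalar∈K   = K-* (scalar∈K g₁) (scalar∈K g₂)
      ; maps-L     = λ z Lz → subst L (affine-∘ c₁ d₁ c₂ d₂ z) (maps-L g₁ _ (maps-L g₂ z Lz))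
      ; admissible = admissible-∘ (admissible g₁) (admissible g₂)
      }

    Ĉ : Pred Carrier 0ℓ
    Ĉ z = A z ⊎ ∃₂ λ c d → NetAdmissible c d × z ≡ lin c d x

    A-image-adjacent : ∀ {y c d} → A y → NetAdmissible c d → Adj y (lin c d x)
    A-image-adjacent Ay g =
      let y′ , Ay′ , gy′≡y = preimage-in-B (admissible g) _ Ay
      in subst (λ t → Adj t _) gy′≡y (lin-Adj (scalar∈K* g) (Adj-sym (A⇒Adj-x Ay′)))

    images-adjacent : ∀ {c₁ d₁ c₂ d₂} → NetAdmissible c₁ d₁ → NetAdmissible c₂ d₂ →
                      lin c₁ d₁ x ≢ lin c₂ d₂ x → Adj (lin c₁ d₁ x) (lin c₂ d₂ x)
    images-adjacent {c₁} {d₁} {c₂} {d₂} g₁ g₂ g₁x≢g₂x with ≟-finite finite c₁ c₂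
    ... | yes refl =
      g₁x≢g₂x , subst S ga-ga≡gx-gx (proj₂ (L-adjacent (maps-L g₁ a L-a) (maps-L g₂ a L-a) g₁a≢g₂a))
      where
        ga-ga≡gx-gx : lin c₁ d₁ a - lin c₁ d₂ a ≡ lin c₁ d₁ x - lin c₁ d₂ x
        ga-ga≡gx-gx = solve 5 (λ c d₁ d₂ x a → (c :* a :+ d₁) :- (c :* a :+ d₂) :=
                                                (c :* x :+ d₁) :- (c :* x :+ d₂))
                        refl c₁ d₁ d₂ x a
        g₁a≢g₂a : lin c₁ d₁ a ≢ lin c₁ d₂ a
        g₁a≢g₂a e = g₁x≢g₂x (combine 1# (solve 5 (λ c d₁ d₂ x a → c :* x :+ d₁ := c :* x :+ d₂
                      :+ :1 :* ((c :* a :+ d₁) :- (c :* a :+ d₂))) refl c₁ d₁ d₂ x a) e)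
    ... | no c₁≢c₂ =
      g₁x≢g₂x , subst S (sym g₁x-g₂x≡) (S-scale (K*-sub (scalar∈K g₁) (scalar∈K g₂) c₁≢c₂) Sx-q)
      where
        q = proj₁ (affine-meet d₁ d₂ c₁≢c₂)
        g₁q≡g₂q = proj₂ (affine-meet d₁ d₂ c₁≢c₂)
        Sx-q : S (x - q)
        Sx-q = proj₂ (A⇒Adj-x (admissible-meet⇒B (admissible g₁) (admissible g₂) c₁≢c₂ g₁q≡g₂q))
        g₁x-g₂x≡ : lin c₁ d₁ x - lin c₂ d₂ x ≡ (c₁ - c₂) * (x - q)
        g₁x-g₂x≡ = combine 1#
          (solve 6 (λ c₁ c₂ d₁ d₂ x q → (c₁ :* x :+ d₁) :- (c₂ :* x :+ d₂) :=
                      (c₁ :- c₂) :* (x :- q) :+ :1 :* ((c₁ :* q :+ d₁) :- (c₂ :* q :+ d₂)))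
                   refl c₁ c₂ d₁ d₂ x q)
          g₁q≡g₂q

    Ĉ-clique : IsClique Ĉ
    Ĉ-clique y z (inj₁ Ay) (inj₁ Az) y≢z = L-adjacent (proj₂ Ay) (proj₂ Az) y≢z
    Ĉ-clique y z (inj₁ Ay) (inj₂ (_ , _ , g , z≡gx)) _ =
      subst (Adj y) (sym z≡gx) (A-image-adjacent Ay g)
    Ĉ-clique y z (inj₂ (_ , _ , g , y≡gx)) (inj₁ Az) _ =
      subst (λ t → Adj t z) (sym y≡gx) (Adj-sym (A-image-adjacent Az g))
    Ĉ-clique y z (inj₂ (_ , _ , g₁ , y≡g₁x)) (inj₂ (_ , _ , g₂ , z≡g₂x)) y≢z =
      subst₂ Adj (sym y≡g₁x) (sym z≡g₂x)
        (images-adjacent g₁ g₂ λ g₁x≡g₂x → y≢z (trans y≡g₁x (trans g₁x≡g₂x (sym z≡g₂x))))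

    x-a∉KdL : ∀ t → InK t → x - a ≢ t * dL
    x-a∉KdL t t∈K e = x∉L (subst L (sym x≡a+dLt) (L-point t∈K))
      where
        x≡a+dLt : x ≡ a + dL * t
        x≡a+dLt = combine 1#
          (solve 4 (λ x a t d → x := (a :+ d :* t) :+ :1 :* ((x :- a) :- t :* d)) refl x a t dL) e

    -- The inverse ψ of g sends z to x, hence z^⊥ ⊇ A to x^⊥; finiteness turns ψ A ⊆ A into g A ⊆ A.
    image-of-x-admissible : ∀ {β z} → InK* β → C z → (∀ w → L w → L (lin β (z - β * x) w)) →
                            NetAdmissible β (z - β * x)
    image-of-x-admissible {β} {z} β∈K* Cz maps-L = record
      { scalar∈K   = proj₁ β∈K*
      ; maps-L     = maps-L
      ; admissible = record { nonzero = proj₂ β∈K* ; maps-B = maps-A ; fixed⇒B = fixed⇒A }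
      }
      where
        d = z - β * x
        β′ = proj₁ (K*-inverse β∈K*)
        β′∈K* = proj₁ (proj₂ (K*-inverse β∈K*))
        ββ′≡1 = proj₂ (proj₂ (K*-inverse β∈K*))

        gx≡z : lin β d x ≡ z
        gx≡z = solve 3 (λ β z x → β :* x :+ (z :- β :* x) := z) refl β z x

        ψ : Carrier → Carrier
        ψ = lin β′ (- (β′ * d))

        ψz≡x : ψ z ≡ x
        ψz≡x = trans (cong ψ (sym gx≡z)) (affine-inverseˡ ββ′≡1 d x)

        ψ-maps-L : ∀ w → L w → L (ψ w)
        ψ-maps-L = injective-closed⇒inverse-closed finite (affine-injective (proj₂ β∈K*)) L maps-L
                     (affine-inverseˡ ββ′≡1 d)

        ψ-maps-A : ∀ w → A w → A (ψ w)
        ψ-maps-A w Aw@(_ , Lw) =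
          inj₂ (subst (λ t → Adj t (ψ w)) ψz≡x (lin-Adj β′∈K* (C-clique z w Cz (A⊆C Aw) z≢w))) , ψ-maps-L w Lw
          where
            z≢w : z ≢ w
            z≢w z≡w = x∉L (subst L ψz≡x (ψ-maps-L z (subst L (sym z≡w) Lw)))

        maps-A : ∀ w → A w → A (lin β d w)
        maps-A = injective-closed⇒inverse-closed finite (affine-injective (proj₂ β′∈K*)) A ψ-maps-A
                   (affine-inverseʳ ββ′≡1 d)

        fixed⇒A : β ≢ 1# → ∀ q → lin β d q ≡ q → A q
        fixed⇒A β≢1 q fq =
          fixed-point-in-A β∈K* β≢1 fq (fixed-point-on-L β∈K* maps-L β≢1 fq) (subst C (sym gx≡z) Cz)

    -- Write z = a + α dL + β (x − a); if β ≠ 0 then z is the image of x under z ↦ β z + (z − β x).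
    C⊆Ĉ : C ⊆ Ĉ
    C⊆Ĉ {z} Cz = by-cases (≟-finite finite β 0#)
      where
        coordinates = K-basis (S-nonzero ds-reps SdL) x-a∉KdL (z - a)
        α = proj₁ coordinates
        β = proj₁ (proj₂ coordinates)
        α∈K = proj₁ (proj₂ (proj₂ coordinates))
        β∈K = proj₁ (proj₂ (proj₂ (proj₂ coordinates)))
        z-a≡ : z - a ≡ α * dL + β * (x - a)
        z-a≡ = proj₂ (proj₂ (proj₂ (proj₂ coordinates)))

        g-maps-L : ∀ w → L w → L (lin β (z - β * x) w)
        g-maps-L w Lw = subst L (sym gw≡) (L-point (K-+ α∈K (K-* β∈K t∈K)))
          where
            t = proj₁ (L-coordinate Lw)
            t∈K = proj₁ (proj₂ (L-coordinate Lw))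
            gw≡ : lin β (z - β * x) w ≡ a + dL * (α + β * t)
            gw≡ = combine₂ 1# β
              (solve 8 (λ x a z d α β w t → β :* w :+ (z :- β :* x) := a :+ d :* (α :+ β :* t)
                          :+ :1 :* ((z :- a) :- (α :* d :+ β :* (x :- a))) :+ β :* (w :- (a :+ d :* t)))
                       refl x a z dL α β w t)
              z-a≡ (proj₂ (proj₂ (L-coordinate Lw)))

        by-cases : Dec (β ≡ 0#) → Ĉ z
        by-cases (yes β≡0) = inj₁ (C∩L⊆A Cz (subst L (sym z≡a+dLα) (L-point α∈K)))
          where
            z≡a+dLα : z ≡ a + dL * α
            z≡a+dLα = combine₂ 1# (x - a)
              (solve 6 (λ z a d α β x → z := a :+ d :* α
                          :+ :1 :* ((z :- a) :- (α :* d :+ β :* (x :- a))) :+ (x :- a) :* (β :- :0))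
                       refl z a dL α β x)
              z-a≡ β≡0
        by-cases (no β≢0) = inj₂ (β , z - β * x , image-of-x-admissible (β∈K , β≢0) Cz g-maps-L ,
                                   sym (solve 3 (λ β z x → β :* x :+ (z :- β :* x) := z) refl β z x))

    Ĉ⊆C : Ĉ ⊆ C
    Ĉ⊆C = proj₂ C-maximal Ĉ Ĉ-clique C⊆Ĉ

    faithful-on-L : ∀ {c d} → (∀ z → L z → lin c d z ≡ z) → ∀ z → lin c d z ≡ z
    faithful-on-L fixes-L = affine-fixing-two-points≡id a≢a+dL (fixes-L a L-a) (fixes-L _ L-a+dL)

    maps-into⇒preserves : ∀ {c d} {P : Pred Carrier 0ℓ} → c ≢ 0# → (∀ z → P z → P (lin c d z)) →
                          PreservesSet (lin c d) P
    maps-into⇒preserves c≢0 P-closed =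
      P-closed , injective-closed⇒surjective finite (affine-injective c≢0) _ P-closed

    module _ {c d c′ d′ : Carrier} (agree : ∀ z → L z → lin c d z ≡ lin c′ d′ z)
             (maps-C : ∀ z → C z → C (lin c d z)) where

      restriction-preserves-A : (∀ z → L z → L (lin c d z)) → c′ ≢ 0# → PreservesSet (lin c′ d′) A
      restriction-preserves-A maps-L c′≢0 = maps-into⇒preserves c′≢0 λ z Az@(_ , Lz) →
        subst A (agree z Lz) (C∩L⊆A (maps-C z (A⊆C Az)) (maps-L z Lz))

      -- g cannot be a translation: it would fix c₀, hence be the identity, and then fix all of L.
      restriction-fixed-point-in-A : InK* c → ∀ c₀ → L c₀ → lin c′ d′ c₀ ≡ c₀ →
                                     (∀ z → L z → lin c′ d′ z ≡ z → z ≡ c₀) → A c₀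
      restriction-fixed-point-in-A c∈K* c₀ Lc₀ g′c₀≡c₀ unique =
        fixed-point-in-A c∈K* c≢1 gc₀≡c₀ Lc₀ (maps-C x Cx)
        where
          gc₀≡c₀ : lin c d c₀ ≡ c₀
          gc₀≡c₀ = trans (agree c₀ Lc₀) g′c₀≡c₀
          c≢1 : c ≢ 1#
          c≢1 c≡1 = a≢a+dL (trans (unique a L-a (fixed a L-a)) (sym (unique _ L-a+dL (fixed _ L-a+dL))))
            where
              fixed : ∀ z → L z → lin c′ d′ z ≡ z
              fixed z Lz = trans (sym (agree z Lz)) (translation-fixing-point≡id c≡1 gc₀≡c₀ z)

    netAdmissible-from-L : ∀ {c d} → InK* c → (∀ z → L z → L (lin c d z)) → (∀ z → A z → A (lin c d z)) →
                           (∀ c₀ → L c₀ → lin c d c₀ ≡ c₀ → (∀ z → L z → lin c d z ≡ z → z ≡ c₀) → A c₀) →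
                           NetAdmissible c d
    netAdmissible-from-L (c∈K , c≢0) maps-L maps-A unique-fixed⇒A = record
      { scalar∈K   = c∈K
      ; maps-L     = maps-L
      ; admissible = record
        { nonzero = c≢0
        ; maps-B  = maps-A
        ; fixed⇒B = λ c≢1 q fq → unique-fixed⇒A q (fixed-point-on-L (c∈K , c≢0) maps-L c≢1 fq) fq
                                    λ z _ fz → affine-fixed-unique c≢1 fz fq
        }
      }

    netAdmissible-preserves-C : ∀ {c d} → NetAdmissible c d → PreservesSet (lin c d) C
    netAdmissible-preserves-C {c} {d} g =
      maps-into⇒preserves (nonzero (admissible g)) λ z Cz → Ĉ⊆C (maps-Ĉ z (C⊆Ĉ Cz))
      where
        maps-Ĉ : ∀ z → Ĉ z → Ĉ (lin c d z)
        maps-Ĉ z (inj₁ Az) = inj₁ (maps-B (admissible g) z Az)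
        maps-Ĉ z (inj₂ (c₁ , d₁ , g₁ , z≡g₁x)) =
          inj₂ (c * c₁ , c * d₁ + d , netAdmissible-∘ g g₁ ,
                trans (cong (lin c d) z≡g₁x) (affine-∘ c d c₁ d₁ x))

proposition5 :
  (p r : ℕ) → IsPowerOf p r → (E : QuadraticExtension r) →
  let open QuadraticExtension E in let open Net E in
  (m : ℕ) → m ≥ 1 → (ds : Fin m → Carrier) → DistinctCosetReps m ds →
  let open WithS ds in
  (L : Pred Carrier 0ℓ) → IsLine L →
  (x : Carrier) → ¬ L x →
  let A = Perp x ∩ L in
  (C : Pred Carrier 0ℓ) → IsMaximalClique C → C x → A ⊆ C →
  -- the group G of linear automorphisms z ↦ c z + d preserving L and C
  -- acts faithfully on L
  ((c d : Carrier) → InK* c → PreservesSet (lin c d) L → PreservesSet (lin c d) C →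
     (∀ z → L z → lin c d z ≡ z) → ∀ z → lin c d z ≡ z)
  ×
  -- the group induced by G on L is exactly the set of linear maps g of L
  -- preserving A and, if g has a unique fixed point c₀ on L, with c₀ ∈ A
  ((c' d' : Carrier) → InK* c' → PreservesSet (lin c' d') L →
     ((Σ Carrier λ c → Σ Carrier λ d → InK* c × PreservesSet (lin c d) L ×
         PreservesSet (lin c d) C × (∀ z → L z → lin c d z ≡ lin c' d' z))
      → (PreservesSet (lin c' d') A ×
         (∀ c₀ → L c₀ → lin c' d' c₀ ≡ c₀ →
            (∀ z → L z → lin c' d' z ≡ z → z ≡ c₀) → A c₀)))
     ×
     ((PreservesSet (lin c' d') A ×
         (∀ c₀ → L c₀ → lin c' d' c₀ ≡ c₀ →
            (∀ z → L z → lin c' d' z ≡ z → z ≡ c₀) → A c₀))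
      → (Σ Carrier λ c → Σ Carrier λ d → InK* c × PreservesSet (lin c d) L ×
         PreservesSet (lin c d) C × (∀ z → L z → lin c d z ≡ lin c' d' z))))
proposition5 _ _ _ E _ _ ds ds-reps L (a , dL , SdL , L⇔Line) x x∉L C C-maximal Cx A⊆C =
  (λ c d _ _ _ fixes-L → faithful-on-L fixes-L) ,
  λ c′ d′ c′∈K* PL′ →
    (λ (c , d , c∈K* , PL , PC , agree) →
       restriction-preserves-A agree (proj₁ PC) (proj₁ PL) (proj₂ c′∈K*) ,
       restriction-fixed-point-in-A agree (proj₁ PC) c∈K*) ,
    (λ (PA′ , unique-fixed⇒A) →
       c′ , d′ , c′∈K* , PL′ ,
       netAdmissible-preserves-C (netAdmissible-from-L c′∈K* (proj₁ PL′) (proj₁ PA′) unique-fixed⇒A) ,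
       λ _ _ → refl)
  where open CliqueOfPointAndLine E ds ds-reps L a dL SdL L⇔Line x x∉L C C-maximal Cx A⊆C
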